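{- Let $k\ge1$, $i\in\{1,\dots,k\}$, and let $\mathbf{n}=[n_1,\dots,n_k]$ be nonnegative integers with $n_i\ge1$; put $n=\sum_{\ell=1}^k n_\ell$ and $d=n+1-n_i$. For a specification $\mathbf{m}$, let $s_k(r;\mathbf{m})$ be the number of sequences over $\{1,\dots,k\}$ in which each integer $j$ appears exactly $m_j$ times and which contain exactly $r$ adjacent pairs $(a_t,a_{t+1})$ with $a_{t+1}-a_t=1$, and let $P_k(w,\mathbf{m})=\sum_r s_k(r;\mathbf{m})w^r$. Writing $\mathbf{n}+j\mathbf{e}^{(i)}=[n_1,\dots,n_i+j,\dots,n_k]$, we have $$\sum_{j=0}^d(-1)^j\binom{d}{j}P_k(w,\mathbf{n}+j\mathbf{e}^{(i)})=0,$$ and for every $r\ge0$, $$\sum_{j=0}^d(-1)^j\binom{d}{j}s_k(r;\mathbf{n}+j\mathbf{e}^{(i)})=0.$$ -}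

module Defs where

open import Data.Nat as ℕ using (ℕ; zero; suc; _+_; _≡ᵇ_)
open import Data.Nat.Combinatorics using (_C_)
open import Data.Integer as ℤ using (ℤ; +_)
open import Data.Fin as Fin using (Fin; toℕ)
open import Data.Fin.Properties using () renaming (_≟_ to _≟ᶠ_)
open import Data.Bool using (Bool; true; false; _∧_; if_then_else_)
open import Data.List as List using (List; []; _∷_; length; map; filterᵇ; allFin; upTo; concatMap)
open import Relation.Nullary.Decidable using (⌊_⌋)
open import Data.Nat.ListAction using (sum)
open import Data.Bool.ListAction using (all)

-- A specification m = [m_1,...,m_k], indexed by Fin k (Fin.zero ↦ value 1, etc.)
Spec : ℕ → Set
Spec k = Fin k → ℕ

total : ∀ {k} → Spec k → ℕ
total {k} m = sum (map m (allFin k))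

seqs : (k len : ℕ) → List (List (Fin k))
seqs k zero = [] ∷ []
seqs k (suc len) = concatMap (λ a → map (a ∷_) (seqs k len)) (allFin k)

occ : ∀ {k} → Fin k → List (Fin k) → ℕ
occ j l = length (filterᵇ (λ a → ⌊ a ≟ᶠ j ⌋) l)

hasSpec : ∀ {k} → Spec k → List (Fin k) → Bool
hasSpec {k} m l = all (λ j → occ j l ≡ᵇ m j) (allFin k)

rises : ∀ {k} → List (Fin k) → ℕ
rises [] = 0
rises (a ∷ []) = 0
rises (a ∷ b ∷ l) = (if toℕ b ≡ᵇ suc (toℕ a) then 1 else 0) + rises (b ∷ l)

s : (k r : ℕ) → Spec k → ℕ
s k r m = length (filterᵇ (λ l → hasSpec m l ∧ (rises l ≡ᵇ r)) (seqs k (total m)))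

-- P_k(w, m) = Σ_r s_k(r; m) w^r, evaluated at an integer w
-- (r ranges over 0..n; s_k(r;m) = 0 for r > n since a sequence of length n has < n adjacent pairs)
P : (k : ℕ) → ℤ → Spec k → ℤ
P k w m = List.foldr ℤ._+_ (+ 0) (map (λ r → (+ s k r m) ℤ.* (w ℤ.^ r)) (upTo (suc (total m))))

bump : ∀ {k} → Spec k → Fin k → ℕ → Spec k
bump m i j t = if ⌊ t ≟ᶠ i ⌋ then m t + j else m t

altSum : ℕ → (ℕ → ℤ) → ℤ
altSum d f = List.foldr ℤ._+_ (+ 0)
  (map (λ j → (ℤ.- (+ 1)) ℤ.^ j ℤ.* (+ (d C j)) ℤ.* f j) (upTo (suc d)))

-- The alternating sum Σ_j (-1)^j C(d,j) f(j) is ± the d-th finite difference of f at 0, so it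
-- vanishes when f is a polynomial of degree < d. It therefore suffices that j ↦ s_k(r; n + j e⁽ⁱ⁾)
-- is a polynomial of degree < d = L + 1, where L = n - n_i is the number of letters other than i.
-- Among sequences that follow a letter i, those with x + 1 letters i either start with i, and then
-- are the sequences with x letters i, or start with some a ≠ i, after which only L - 1 letters
-- other than i remain; by induction on L the first difference in x has degree < L. Since the first
-- letter may form a rise with its predecessor, counts are taken after a given letter and with an
-- offset on the number of rises. P_k is a combination of the s_k with coefficients w^r.
module Submission where

open import Defs

open import Data.Bool using (Bool; true; false; _∧_; if_then_else_; T)
open import Data.Bool.Properties using (∧-zeroʳ)
open import Data.Bool.ListAction using (all; and)
open import Data.Empty using (⊥-elim)
open import Data.Fin as Fin using (Fin; toℕ; punchIn)
open import Data.Fin.Properties using (punchInᵢ≢i) renaming (_≟_ to _≟ᶠ_)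
open import Data.Integer using (ℤ; +_)
import Data.Integer.Properties as ℤP
open import Data.Integer.Tactic.RingSolver using (solve-∀)
open import Data.List using (List; []; _∷_; _++_; length; map; filterᵇ; allFin; applyUpTo; concatMap; tabulate)
open import Data.List.Properties using (length-++; map-cong; map-tabulate; filter-++; filter-≐; filter-none)
open import Data.List.Relation.Unary.All as All using (All; []; _∷_)
open import Data.List.Membership.Propositional using (_∈_)
open import Data.List.Membership.Propositional.Properties using (∈-allFin)
open import Data.List.Relation.Unary.Any using (here; there)
open import Data.Maybe using (Maybe; just; nothing)
open import Data.Nat using (ℕ; zero; suc; _≤_; _<_; _≤′_; ≤′-refl; ≤′-step; z≤n; s≤s; _≡ᵇ_)
open import Data.Nat.Combinatorics using (_C_; nCk+nC[k+1]≡[n+1]C[k+1]; k>n⇒nCk≡0)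
open import Data.Nat.ListAction using (sum)
import Data.Nat.Properties as ℕP
open import Data.Product using (_×_; _,_)
open import Function using (_∘_; id)
open import Relation.Binary.PropositionalEquality
open import Relation.Nullary using (yes; no)
open import Relation.Nullary.Decidable using (⌊_⌋; T?)

module _ {A : Set} where

  open import Data.Nat using (_+_)

  length-filterᵇ-cong : ∀ {p q : A → Bool} → (∀ x → p x ≡ q x) →
    ∀ xs → length (filterᵇ p xs) ≡ length (filterᵇ q xs)
  length-filterᵇ-cong {p} {q} eq xs =
    cong length (filter-≐ (T? ∘ p) (T? ∘ q) ((λ {x} → subst T (eq x)) , (λ {x} → subst T (sym (eq x)))) xs)

  length-filterᵇ-none : ∀ {p : A → Bool} {xs} → All (λ x → p x ≡ false) xs → length (filterᵇ p xs) ≡ 0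
  length-filterᵇ-none {p} none = cong length (filter-none (T? ∘ p) (All.map (subst T) none))

  length-filterᵇ-map : ∀ {B : Set} (p : A → Bool) (g : B → A) ys →
    length (filterᵇ p (map g ys)) ≡ length (filterᵇ (p ∘ g) ys)
  length-filterᵇ-map p g []       = refl
  length-filterᵇ-map p g (y ∷ ys) with p (g y)
  ... | true  = cong suc (length-filterᵇ-map p g ys)
  ... | false = length-filterᵇ-map p g ys

  length-filterᵇ-concatMap : ∀ {B : Set} (p : A → Bool) (f : B → List A) xs →
    length (filterᵇ p (concatMap f xs)) ≡ sum (map (λ x → length (filterᵇ p (f x))) xs)
  length-filterᵇ-concatMap p f []       = refl
  length-filterᵇ-concatMap p f (x ∷ xs) = begin
    length (filterᵇ p (f x ++ concatMap f xs))
      ≡⟨ cong length (filter-++ (T? ∘ p) (f x) (concatMap f xs)) ⟩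
    length (filterᵇ p (f x) ++ filterᵇ p (concatMap f xs))
      ≡⟨ length-++ (filterᵇ p (f x)) ⟩
    length (filterᵇ p (f x)) + length (filterᵇ p (concatMap f xs))
      ≡⟨ cong (_+_ (length (filterᵇ p (f x)))) (length-filterᵇ-concatMap p f xs) ⟩
    length (filterᵇ p (f x)) + sum (map (λ y → length (filterᵇ p (f y))) xs)
      ∎
    where open ≡-Reasoning

  all-false : ∀ {p : A → Bool} {x xs} → x ∈ xs → p x ≡ false → all p xs ≡ false
  all-false {p} {xs = y ∷ ys} (here refl) px≡false rewrite px≡false = refl
  all-false {p} {xs = y ∷ ys} (there x∈ys) px≡false
    rewrite all-false {p} x∈ys px≡false = ∧-zeroʳ (p y)

  sum-map-zero : ∀ {f : A → ℕ} → (∀ x → f x ≡ 0) → ∀ xs → sum (map f xs) ≡ 0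
  sum-map-zero f≡0 []       = refl
  sum-map-zero f≡0 (x ∷ xs) rewrite f≡0 x = sum-map-zero f≡0 xs

sum-allFin-punchIn : ∀ {n} (i : Fin (suc n)) (g : Fin (suc n) → ℕ) →
  sum (map g (allFin (suc n))) ≡ g i Data.Nat.+ sum (map (g ∘ punchIn i) (allFin n))
sum-allFin-punchIn i g = begin
  sum (map g (allFin _))                      ≡⟨ cong sum (map-tabulate id g) ⟩
  sum (tabulate g)                            ≡⟨ sum-tabulate-punchIn i g ⟩
  g i + sum (tabulate (g ∘ punchIn i))        ≡⟨ cong (λ gs → g i + sum gs) (map-tabulate id (g ∘ punchIn i)) ⟨
  g i + sum (map (g ∘ punchIn i) (allFin _))  ∎
  where
  open ≡-Reasoning
  open import Data.Nat using (_+_)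
  open import Algebra.Properties.CommutativeSemigroup ℕP.+-commutativeSemigroup using (x∙yz≈y∙xz)
  sum-tabulate-punchIn : ∀ {n} (i : Fin (suc n)) (g : Fin (suc n) → ℕ) →
    sum (tabulate g) ≡ g i + sum (tabulate (g ∘ punchIn i))
  sum-tabulate-punchIn             Fin.zero    g = refl
  sum-tabulate-punchIn {suc n} (Fin.suc i) g =
    trans (cong (_+_ (g Fin.zero)) (sum-tabulate-punchIn i (g ∘ Fin.suc)))
          (x∙yz≈y∙xz (g Fin.zero) (g (Fin.suc i)) (sum (tabulate (g ∘ Fin.suc ∘ punchIn i))))

≟ᶠ-refl : ∀ {n} (a : Fin n) → ⌊ a ≟ᶠ a ⌋ ≡ true
≟ᶠ-refl a with a ≟ᶠ a
... | yes _   = refl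
... | no a≢a = ⊥-elim (a≢a refl)

<⇒≡ᵇ-false : ∀ {m n} → m < n → (m ≡ᵇ n) ≡ false
<⇒≡ᵇ-false {m} {n} m<n with m ≡ᵇ n in eq
... | false = refl
... | true  = ⊥-elim (ℕP.<-irrefl (ℕP.≡ᵇ⇒≡ m n (subst T (sym eq) _)) m<n)

module Differences where

  open import Data.Integer using (_+_; _-_; -_; _*_; _^_)

  [a-b]+[c-d]≡[a+c]-[b+d] : ∀ a b c d → (a - b) + (c - d) ≡ (a + c) - (b + d)
  [a-b]+[c-d]≡[a+c]-[b+d] = solve-∀

  ∑ : ℕ → (ℕ → ℤ) → ℤ
  ∑ zero    f = + 0
  ∑ (suc n) f = f 0 + ∑ n (f ∘ suc)

  foldr-map-applyUpTo : ∀ (h : ℕ → ℤ) g n →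
    Data.List.foldr _+_ (+ 0) (map h (applyUpTo g n)) ≡ ∑ n (h ∘ g)
  foldr-map-applyUpTo h g zero    = refl
  foldr-map-applyUpTo h g (suc n) = cong (_+_ (h (g 0))) (foldr-map-applyUpTo h (g ∘ suc) n)

  ∑-cong-< : ∀ n {f g : ℕ → ℤ} → (∀ j → j < n → f j ≡ g j) → ∑ n f ≡ ∑ n g
  ∑-cong-< zero    eq = refl
  ∑-cong-< (suc n) eq = cong₂ _+_ (eq 0 (s≤s z≤n)) (∑-cong-< n (λ j j<n → eq (suc j) (s≤s j<n)))

  ∑-cong : ∀ n {f g : ℕ → ℤ} → (∀ j → f j ≡ g j) → ∑ n f ≡ ∑ n g
  ∑-cong n eq = ∑-cong-< n (λ j _ → eq j)

  ∑-minus : ∀ n (f g : ℕ → ℤ) → ∑ n (λ j → f j - g j) ≡ ∑ n f - ∑ n g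
  ∑-minus zero    f g = refl
  ∑-minus (suc n) f g = trans (cong (_+_ (f 0 - g 0)) (∑-minus n (f ∘ suc) (g ∘ suc)))
                          ([a-b]+[c-d]≡[a+c]-[b+d] (f 0) (g 0) (∑ n (f ∘ suc)) (∑ n (g ∘ suc)))

  ∑-suc : ∀ n (f : ℕ → ℤ) → ∑ (suc n) f ≡ ∑ n f + f n
  ∑-suc zero    f = ℤP.+-comm (f 0) (+ 0)
  ∑-suc (suc n) f = trans (cong (_+_ (f 0)) (∑-suc n (f ∘ suc)))
                          (sym (ℤP.+-assoc (f 0) (∑ n (f ∘ suc)) (f (suc n))))

  ∑-extend : ∀ {n m} (f : ℕ → ℤ) → n ≤ m → (∀ j → n ≤ j → f j ≡ + 0) → ∑ m f ≡ ∑ n f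
  ∑-extend {n} f n≤m vanish = go (ℕP.≤⇒≤′ n≤m)
    where
    go : ∀ {m} → n ≤′ m → ∑ m f ≡ ∑ n f
    go ≤′-refl              = refl
    go (≤′-step {m} n≤′m) = begin
      ∑ (suc m) f   ≡⟨ ∑-suc m f ⟩
      ∑ m f + f m   ≡⟨ cong₂ _+_ (go n≤′m) (vanish m (ℕP.≤′⇒≤ n≤′m)) ⟩
      ∑ n f + + 0   ≡⟨ ℤP.+-identityʳ (∑ n f) ⟩
      ∑ n f         ∎
      where open ≡-Reasoning

  binomialTerm : ℕ → (ℕ → ℤ) → ℕ → ℤ
  binomialTerm d f j = (- (+ 1)) ^ j * + (d C j) * f j

  altSum≡∑ : ∀ d f → altSum d f ≡ ∑ (suc d) (binomialTerm d f)
  altSum≡∑ d f = foldr-map-applyUpTo (binomialTerm d f) id (suc d)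

  altSum-cong-≤ : ∀ d {f g : ℕ → ℤ} → (∀ j → j ≤ d → f j ≡ g j) → altSum d f ≡ altSum d g
  altSum-cong-≤ d {f} {g} eq = begin
    altSum d f                     ≡⟨ altSum≡∑ d f ⟩
    ∑ (suc d) (binomialTerm d f)   ≡⟨ ∑-cong-< (suc d) termwise ⟩
    ∑ (suc d) (binomialTerm d g)   ≡⟨ altSum≡∑ d g ⟨
    altSum d g                     ∎
    where
    open ≡-Reasoning
    termwise : ∀ j → j < suc d → binomialTerm d f j ≡ binomialTerm d g j
    termwise j (s≤s j≤d) = cong ((- (+ 1)) ^ j * + (d C j) *_) (eq j j≤d)

  binomialTerm-pascal : ∀ d f j →
    binomialTerm (suc d) f (suc j) ≡ binomialTerm d f (suc j) - binomialTerm d (f ∘ suc) j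
  binomialTerm-pascal d f j = begin
    (- (+ 1)) ^ suc j * + (suc d C suc j) * f (suc j)
      ≡⟨ cong (λ c → (- (+ 1)) ^ suc j * + c * f (suc j)) (nCk+nC[k+1]≡[n+1]C[k+1] d j) ⟨
    (- (+ 1)) ^ suc j * + (d C j Data.Nat.+ d C suc j) * f (suc j)
      ≡⟨ cong (λ c → (- (+ 1)) ^ suc j * c * f (suc j)) (ℤP.pos-+ (d C j) (d C suc j)) ⟩
    (- (+ 1)) * (- (+ 1)) ^ j * (+ (d C j) + + (d C suc j)) * f (suc j)
      ≡⟨ distribute ((- (+ 1)) ^ j) (+ (d C j)) (+ (d C suc j)) (f (suc j)) ⟩
    binomialTerm d f (suc j) - binomialTerm d (f ∘ suc) j
      ∎
    where
    open ≡-Reasoning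
    distribute : ∀ s a b x → (- (+ 1)) * s * (a + b) * x ≡ (- (+ 1)) * s * b * x - s * a * x
    distribute = solve-∀

  altSum-suc : ∀ d f → altSum (suc d) f ≡ altSum d f - altSum d (f ∘ suc)
  altSum-suc d f = begin
    altSum (suc d) f
      ≡⟨ altSum≡∑ (suc d) f ⟩
    binomialTerm d f 0 + ∑ (suc d) (binomialTerm (suc d) f ∘ suc)
      ≡⟨ cong (_+_ (binomialTerm d f 0)) (∑-cong (suc d) (binomialTerm-pascal d f)) ⟩
    binomialTerm d f 0 + ∑ (suc d) (λ j → binomialTerm d f (suc j) - binomialTerm d (f ∘ suc) j)
      ≡⟨ cong (_+_ (binomialTerm d f 0)) (∑-minus (suc d) (binomialTerm d f ∘ suc) (binomialTerm d (f ∘ suc))) ⟩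
    binomialTerm d f 0 + (∑ (suc d) (binomialTerm d f ∘ suc) - ∑ (suc d) (binomialTerm d (f ∘ suc)))
      ≡⟨ ℤP.+-assoc (binomialTerm d f 0) _ _ ⟨
    ∑ (suc (suc d)) (binomialTerm d f) - ∑ (suc d) (binomialTerm d (f ∘ suc))
      ≡⟨ cong (_- ∑ (suc d) (binomialTerm d (f ∘ suc))) (∑-extend {suc d} (binomialTerm d f) (ℕP.n≤1+n (suc d)) beyond-d) ⟩
    ∑ (suc d) (binomialTerm d f) - ∑ (suc d) (binomialTerm d (f ∘ suc))
      ≡⟨ cong₂ _-_ (altSum≡∑ d f) (altSum≡∑ d (f ∘ suc)) ⟨
    altSum d f - altSum d (f ∘ suc)
      ∎
    where
    open ≡-Reasoning
    beyond-d : ∀ j → suc d ≤ j → binomialTerm d f j ≡ + 0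
    beyond-d j d<j rewrite k>n⇒nCk≡0 d<j =
      trans (cong (_* f j) (ℤP.*-zeroʳ ((- (+ 1)) ^ j))) (ℤP.*-zeroˡ (f j))

  Δ : (ℕ → ℤ) → ℕ → ℤ
  Δ f x = f (suc x) - f x

  -- Deg< e f: the e-th difference of f vanishes, i.e. f is a polynomial of degree < e.
  Deg< : ℕ → (ℕ → ℤ) → Set
  Deg< zero    f = ∀ x → f x ≡ + 0
  Deg< (suc e) f = Deg< e (Δ f)

  Deg<-cong : ∀ e {f g : ℕ → ℤ} → (∀ x → f x ≡ g x) → Deg< e f → Deg< e g
  Deg<-cong zero    eq deg x = trans (sym (eq x)) (deg x)
  Deg<-cong (suc e) eq deg   = Deg<-cong e (λ x → cong₂ _-_ (eq (suc x)) (eq x)) deg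

  Deg<-∘suc : ∀ e {f : ℕ → ℤ} → Deg< e f → Deg< e (f ∘ suc)
  Deg<-∘suc zero    deg x = deg (suc x)
  Deg<-∘suc (suc e) deg   = Deg<-∘suc e deg

  Deg<-shift : ∀ e q {f : ℕ → ℤ} → Deg< e f → Deg< e (λ x → f (q Data.Nat.+ x))
  Deg<-shift e zero    deg = deg
  Deg<-shift e (suc q) deg = Deg<-shift e q (Deg<-∘suc e deg)

  Deg<-suc : ∀ e {f : ℕ → ℤ} → Deg< e f → Deg< (suc e) f
  Deg<-suc zero    {f} deg x rewrite deg x | deg (suc x) = refl
  Deg<-suc (suc e)     deg   = Deg<-suc e deg

  Deg<-0 : ∀ e → Deg< e (λ _ → + 0)
  Deg<-0 zero    x = refl
  Deg<-0 (suc e)   = Deg<-0 e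

  Deg<-+ : ∀ e {f g : ℕ → ℤ} → Deg< e f → Deg< e g → Deg< e (λ x → f x + g x)
  Deg<-+ zero    {f} {g} df dg x rewrite df x | dg x = refl
  Deg<-+ (suc e) {f} {g} df dg =
    Deg<-cong e (λ x → [a-b]+[c-d]≡[a+c]-[b+d] (f (suc x)) (f x) (g (suc x)) (g x)) (Deg<-+ e df dg)

  Deg<-*ʳ : ∀ e c {f : ℕ → ℤ} → Deg< e f → Deg< e (λ x → f x * c)
  Deg<-*ʳ zero    c {f} deg x rewrite deg x = ℤP.*-zeroˡ c
  Deg<-*ʳ (suc e) c {f} deg =
    Deg<-cong e (λ x → sym (distribute (f (suc x)) (f x) c)) (Deg<-*ʳ e c deg)
    where
    distribute : ∀ a b c → a * c - b * c ≡ (a - b) * c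
    distribute = solve-∀

  Deg<-∑ : ∀ e N (g : ℕ → ℕ → ℤ) → (∀ r → Deg< e (g r)) → Deg< e (λ x → ∑ N (λ r → g r x))
  Deg<-∑ e zero    g deg = Deg<-0 e
  Deg<-∑ e (suc N) g deg = Deg<-+ e (deg 0) (Deg<-∑ e N (g ∘ suc) (deg ∘ suc))

  Deg<-sum : ∀ {A : Set} e (xs : List A) (g : A → ℕ → ℕ) → (∀ a → Deg< e (+_ ∘ g a)) →
    Deg< e (λ x → + sum (map (λ a → g a x) xs))
  Deg<-sum e []       g deg = Deg<-0 e
  Deg<-sum e (a ∷ xs) g deg =
    Deg<-cong e (λ x → sym (ℤP.pos-+ (g a x) (sum (map (λ b → g b x) xs))))
      (Deg<-+ e (deg a) (Deg<-sum e xs g deg))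

  altSum-Δ : ∀ d f → altSum d (Δ f) ≡ altSum d (f ∘ suc) - altSum d f
  altSum-Δ d f = begin
    altSum d (Δ f)                                       ≡⟨ altSum≡∑ d (Δ f) ⟩
    ∑ (suc d) (binomialTerm d (Δ f))                     ≡⟨ ∑-cong (suc d) (λ j → distribute ((- (+ 1)) ^ j * + (d C j)) (f (suc j)) (f j)) ⟩
    ∑ (suc d) (λ j → binomialTerm d (f ∘ suc) j - binomialTerm d f j)
                                                         ≡⟨ ∑-minus (suc d) (binomialTerm d (f ∘ suc)) (binomialTerm d f) ⟩
    ∑ (suc d) (binomialTerm d (f ∘ suc)) - ∑ (suc d) (binomialTerm d f)
                                                         ≡⟨ cong₂ _-_ (altSum≡∑ d (f ∘ suc)) (altSum≡∑ d f) ⟨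
    altSum d (f ∘ suc) - altSum d f                      ∎
    where
    open ≡-Reasoning
    distribute : ∀ c a b → c * (a - b) ≡ c * a - c * b
    distribute = solve-∀

  altSum-Deg< : ∀ d f → Deg< d f → altSum d f ≡ + 0
  altSum-Deg< zero    f deg rewrite deg 0 = refl
  altSum-Deg< (suc d) f deg = begin
    altSum (suc d) f                 ≡⟨ altSum-suc d f ⟩
    altSum d f - altSum d (f ∘ suc)  ≡⟨ antisym-sub (altSum d f) (altSum d (f ∘ suc)) ⟩
    - (altSum d (f ∘ suc) - altSum d f) ≡⟨ cong -_ (altSum-Δ d f) ⟨
    - altSum d (Δ f)                 ≡⟨ cong -_ (altSum-Deg< d (Δ f) deg) ⟩
    + 0                              ∎
    where
    open ≡-Reasoning
    antisym-sub : ∀ a b → a - b ≡ - (b - a)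
    antisym-sub = solve-∀

open Differences

ifPositive : ℕ → ℕ → ℕ
ifPositive zero    _ = 0
ifPositive (suc _) x = x

ifPositive-0 : ∀ n → ifPositive n 0 ≡ 0
ifPositive-0 zero    = refl
ifPositive-0 (suc n) = refl

Deg<-ifPositive : ∀ e n {f : ℕ → ℕ} → Deg< e (+_ ∘ f) →
  Deg< e (λ x → + ifPositive n (f x))
Deg<-ifPositive e zero    deg = Deg<-0 e
Deg<-ifPositive e (suc n) deg = deg

module Counting {k : ℕ} where

  open import Data.Nat using (_+_; _∸_)
  open import Data.Integer using (_*_; _^_)

  rise : Maybe (Fin k) → Fin k → ℕ
  rise nothing  a = 0
  rise (just b) a = if toℕ a ≡ᵇ suc (toℕ b) then 1 else 0

  rise≤1 : ∀ p a → rise p a ≤ 1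
  rise≤1 nothing  a = z≤n
  rise≤1 (just b) a with toℕ a ≡ᵇ suc (toℕ b)
  ... | true  = s≤s z≤n
  ... | false = z≤n

  rise-self : ∀ a → rise (just a) a ≡ 0
  rise-self a rewrite <⇒≡ᵇ-false (ℕP.n<1+n (toℕ a)) = refl

  risesAfter : Maybe (Fin k) → List (Fin k) → ℕ
  risesAfter nothing  l = rises l
  risesAfter (just b) l = rises (b ∷ l)

  risesAfter-[] : ∀ p → risesAfter p [] ≡ 0
  risesAfter-[] nothing  = refl
  risesAfter-[] (just b) = refl

  risesAfter-∷ : ∀ p a l → risesAfter p (a ∷ l) ≡ rise p a + risesAfter (just a) l
  risesAfter-∷ nothing  a l = refl
  risesAfter-∷ (just b) a l = refl

  count : Maybe (Fin k) → Spec k → ℕ → ℕ → ℕ → ℕ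
  count p m c r len = length (filterᵇ (λ l → hasSpec m l ∧ (risesAfter p l + c ≡ᵇ r)) (seqs k len))

  decAt : Spec k → Fin k → Spec k
  decAt m a t = if ⌊ a ≟ᶠ t ⌋ then m t ∸ 1 else m t

  startingWith : Maybe (Fin k) → Spec k → ℕ → ℕ → ℕ → Fin k → ℕ
  startingWith p m c r len a = ifPositive (m a) (count (just a) (decAt m a) (rise p a + c) r len)

  hasSpec-cong : ∀ {m m' : Spec k} → (∀ t → m t ≡ m' t) → ∀ l → hasSpec m l ≡ hasSpec m' l
  hasSpec-cong eq l = cong and (map-cong (λ j → cong (occ j l ≡ᵇ_) (eq j)) (allFin k))

  hasSpec-[] : ∀ {m : Spec k} i → 0 < m i → hasSpec m [] ≡ false
  hasSpec-[] {m} i 0<mᵢ = all-false (∈-allFin i) (<⇒≡ᵇ-false 0<mᵢ)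

  occ-∷ : ∀ (j a : Fin k) l → occ j (a ∷ l) ≡ (if ⌊ a ≟ᶠ j ⌋ then suc (occ j l) else occ j l)
  occ-∷ j a l with a ≟ᶠ j
  ... | yes _ = refl
  ... | no _  = refl

  hasSpec-∷-zero : ∀ (m : Spec k) a l → m a ≡ 0 → hasSpec m (a ∷ l) ≡ false
  hasSpec-∷-zero m a l mₐ≡0 = all-false (∈-allFin a) occₐ≢mₐ
    where
    occₐ≢mₐ : (occ a (a ∷ l) ≡ᵇ m a) ≡ false
    occₐ≢mₐ rewrite occ-∷ a a l | ≟ᶠ-refl a | mₐ≡0 = refl

  hasSpec-∷-suc : ∀ (m : Spec k) a l q → m a ≡ suc q → hasSpec m (a ∷ l) ≡ hasSpec (decAt m a) l
  hasSpec-∷-suc m a l q mₐ≡1+q = cong and (map-cong occ-matches (allFin k))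
    where
    occ-matches : ∀ j → (occ j (a ∷ l) ≡ᵇ m j) ≡ (occ j l ≡ᵇ decAt m a j)
    occ-matches j with a ≟ᶠ j
    ... | yes refl rewrite mₐ≡1+q = refl
    ... | no _     = refl

  count-cong : ∀ p {m m' : Spec k} c r len → (∀ t → m t ≡ m' t) → count p m c r len ≡ count p m' c r len
  count-cong p c r len eq =
    length-filterᵇ-cong (λ l → cong (_∧ (risesAfter p l + c ≡ᵇ r)) (hasSpec-cong eq l)) (seqs k len)

  count-suc : ∀ p m c r len → count p m c r (suc len) ≡ sum (map (startingWith p m c r len) (allFin k))
  count-suc p m c r len = begin
    length (filterᵇ counted (concatMap (λ a → map (a ∷_) (seqs k len)) (allFin k)))
      ≡⟨ length-filterᵇ-concatMap counted (λ a → map (a ∷_) (seqs k len)) (allFin k) ⟩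
    sum (map (λ a → length (filterᵇ counted (map (a ∷_) (seqs k len)))) (allFin k))
      ≡⟨ cong sum (map-cong startingWith-a (allFin k)) ⟩
    sum (map (startingWith p m c r len) (allFin k))
      ∎
    where
    open ≡-Reasoning
    counted : List (Fin k) → Bool
    counted l = hasSpec m l ∧ (risesAfter p l + c ≡ᵇ r)
    startingWith-a : ∀ a → length (filterᵇ counted (map (a ∷_) (seqs k len))) ≡ startingWith p m c r len a
    startingWith-a a with m a in mₐ≡
    ... | zero = trans (length-filterᵇ-map counted (a ∷_) (seqs k len))
                       (length-filterᵇ-none (All.universal impossible (seqs k len)))
      where
      impossible : ∀ l → counted (a ∷ l) ≡ false
      impossible l = cong (_∧ _) (hasSpec-∷-zero m a l mₐ≡)
    ... | suc q = trans (length-filterᵇ-map counted (a ∷_) (seqs k len))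
                        (length-filterᵇ-cong peel (seqs k len))
      where
      peel : ∀ l → counted (a ∷ l) ≡ (hasSpec (decAt m a) l ∧ (risesAfter (just a) l + (rise p a + c) ≡ᵇ r))
      peel l = cong₂ _∧_ (hasSpec-∷-suc m a l q mₐ≡)
        (cong (_≡ᵇ r) (begin
          risesAfter p (a ∷ l) + c                 ≡⟨ cong (_+ c) (risesAfter-∷ p a l) ⟩
          rise p a + risesAfter (just a) l + c     ≡⟨ cong (_+ c) (ℕP.+-comm (rise p a) _) ⟩
          risesAfter (just a) l + rise p a + c     ≡⟨ ℕP.+-assoc (risesAfter (just a) l) (rise p a) c ⟩
          risesAfter (just a) l + (rise p a + c)   ∎))

  count-[] : ∀ p m c r → (hasSpec m [] ∧ (risesAfter p [] + c ≡ᵇ r)) ≡ false → count p m c r 0 ≡ 0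
  count-[] p m c r rejected =
    length-filterᵇ-none {p = λ l → hasSpec m l ∧ (risesAfter p l + c ≡ᵇ r)} {[] ∷ []} (rejected ∷ [])

  count-occ-overflow : ∀ i len p m c r → len < m i → count p m c r len ≡ 0
  count-occ-overflow i zero      p m c r 0<mᵢ =
    count-[] p m c r (cong (_∧ (risesAfter p [] + c ≡ᵇ r)) (hasSpec-[] {m} i 0<mᵢ))
  count-occ-overflow i (suc len) p m c r len<mᵢ =
    trans (count-suc p m c r len) (sum-map-zero none-starting (allFin k))
    where
    none-starting : ∀ a → startingWith p m c r len a ≡ 0
    none-starting a =
      trans (cong (ifPositive (m a)) (count-occ-overflow i len (just a) (decAt m a) (rise p a + c) r len<decAt))
            (ifPositive-0 (m a))
      where
      len<decAt : len < decAt m a i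
      len<decAt with a ≟ᶠ i
      ... | yes _ = ℕP.∸-monoˡ-< len<mᵢ (s≤s z≤n)
      ... | no _  = ℕP.<-trans (ℕP.n<1+n len) len<mᵢ

  count-rises-overflow : ∀ len p m c r → len + c < r → count p m c r len ≡ 0
  count-rises-overflow zero      p m c r c<r = count-[] p m c r (begin
    hasSpec m [] ∧ (risesAfter p [] + c ≡ᵇ r)  ≡⟨ cong (λ n → hasSpec m [] ∧ (n + c ≡ᵇ r)) (risesAfter-[] p) ⟩
    hasSpec m [] ∧ (c ≡ᵇ r)                    ≡⟨ cong (hasSpec m [] ∧_) (<⇒≡ᵇ-false c<r) ⟩
    hasSpec m [] ∧ false                       ≡⟨ ∧-zeroʳ (hasSpec m []) ⟩
    false                                      ∎)
    where open ≡-Reasoning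
  count-rises-overflow (suc len) p m c r len+c<r =
    trans (count-suc p m c r len) (sum-map-zero none-starting (allFin k))
    where
    none-starting : ∀ a → startingWith p m c r len a ≡ 0
    none-starting a =
      trans (cong (ifPositive (m a)) (count-rises-overflow len (just a) (decAt m a) (rise p a + c) r bound))
            (ifPositive-0 (m a))
      where
      bound : len + (rise p a + c) < r
      bound = begin-strict
        len + (rise p a + c)  ≤⟨ ℕP.+-monoʳ-≤ len (ℕP.+-monoˡ-≤ c (rise≤1 p a)) ⟩
        len + suc c           ≡⟨ ℕP.+-suc len c ⟩
        suc len + c           <⟨ len+c<r ⟩
        r                     ∎
        where open ℕP.≤-Reasoning

  s≡count : ∀ r m → s k r m ≡ count nothing m 0 r (total m)
  s≡count r m =
    length-filterᵇ-cong (λ l → cong (λ n → hasSpec m l ∧ (n ≡ᵇ r)) (sym (ℕP.+-identityʳ (rises l))))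
      (seqs k (total m))

  P≡∑ : ∀ w m {N} → total m < N → P k w m ≡ ∑ N (λ r → + s k r m * w ^ r)
  P≡∑ w m {N} total<N = trans (foldr-map-applyUpTo coefficient id (suc (total m)))
                               (sym (∑-extend coefficient total<N vanishes))
    where
    coefficient : ℕ → ℤ
    coefficient r = + s k r m * w ^ r
    vanishes : ∀ r → suc (total m) ≤ r → coefficient r ≡ + 0
    vanishes r total<r
      rewrite s≡count r m
            | count-rises-overflow (total m) nothing m 0 r (subst (_< r) (sym (ℕP.+-identityʳ _)) total<r)
            = ℤP.*-zeroˡ (w ^ r)

module Polynomiality {k : ℕ} (i : Fin (suc k)) where

  open import Data.Nat using (_+_)
  open import Data.Integer using (_-_) renaming (_+_ to _+ℤ_)
  open Counting {suc k}

  setAt : Spec (suc k) → ℕ → Spec (suc k)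
  setAt m x t = if ⌊ i ≟ᶠ t ⌋ then x else m t

  setAt-i : ∀ m x → setAt m x i ≡ x
  setAt-i m x rewrite ≟ᶠ-refl i = refl

  setAt-≢ : ∀ m x {a} → a ≢ i → setAt m x a ≡ m a
  setAt-≢ m x {a} a≢i with i ≟ᶠ a
  ... | yes i≡a = ⊥-elim (a≢i (sym i≡a))
  ... | no _    = refl

  decAt-setAt-i : ∀ m x t → decAt (setAt m (suc x)) i t ≡ setAt m x t
  decAt-setAt-i m x t with i ≟ᶠ t
  ... | yes _ = refl
  ... | no _  = refl

  decAt-setAt-≢ : ∀ m x {a} → a ≢ i → ∀ t → decAt (setAt m x) a t ≡ setAt (decAt m a) x t
  decAt-setAt-≢ m x {a} a≢i t with a ≟ᶠ t | i ≟ᶠ t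
  ... | yes refl | yes refl = ⊥-elim (a≢i refl)
  ... | yes _    | no _     = refl
  ... | no _     | yes _    = refl
  ... | no _     | no _     = refl

  total-setAt : ∀ m x → total (setAt m x) ≡ x + sum (map (m ∘ punchIn i) (allFin k))
  total-setAt m x = begin
    total (setAt m x)
      ≡⟨ sum-allFin-punchIn i (setAt m x) ⟩
    setAt m x i + sum (map (setAt m x ∘ punchIn i) (allFin k))
      ≡⟨ cong₂ _+_ (setAt-i m x) (cong sum (map-cong (λ a → setAt-≢ m x (punchInᵢ≢i i a)) (allFin k))) ⟩
    x + sum (map (m ∘ punchIn i) (allFin k))
      ∎
    where open ≡-Reasoning

  setAt-self : ∀ m t → setAt m (m i) t ≡ m t
  setAt-self m t with i ≟ᶠ t
  ... | yes refl = refl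
  ... | no _     = refl

  startingWith-setAt-i : ∀ p m c r len x →
    startingWith p (setAt m (suc x)) c r len i ≡ count (just i) (setAt m x) (rise p i + c) r len
  startingWith-setAt-i p m c r len x rewrite setAt-i m (suc x) =
    count-cong (just i) (rise p i + c) r len (decAt-setAt-i m x)

  startingWith-setAt-≢ : ∀ p m c r len x {a} → a ≢ i →
    startingWith p (setAt m x) c r len a ≡ ifPositive (m a) (count (just a) (setAt (decAt m a) x) (rise p a + c) r len)
  startingWith-setAt-≢ p m c r len x {a} a≢i =
    cong₂ ifPositive (setAt-≢ m x a≢i) (count-cong (just a) (rise p a + c) r len (decAt-setAt-≢ m x a≢i))

  startingWithOther : Maybe (Fin (suc k)) → Spec (suc k) → ℕ → ℕ → ℕ → ℕ → ℕ
  startingWithOther p m c r len x = sum (map (startingWith p (setAt m (suc x)) c r len ∘ punchIn i) (allFin k))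

  count-split : ∀ p m c r len x →
    count p (setAt m (suc x)) c r (suc len)
      ≡ count (just i) (setAt m x) (rise p i + c) r len + startingWithOther p m c r len x
  count-split p m c r len x = begin
    count p (setAt m (suc x)) c r (suc len)
      ≡⟨ count-suc p (setAt m (suc x)) c r len ⟩
    sum (map (startingWith p (setAt m (suc x)) c r len) (allFin (suc k)))
      ≡⟨ sum-allFin-punchIn i _ ⟩
    startingWith p (setAt m (suc x)) c r len i + startingWithOther p m c r len x
      ≡⟨ cong (_+ startingWithOther p m c r len x) (startingWith-setAt-i p m c r len x) ⟩
    count (just i) (setAt m x) (rise p i + c) r len + startingWithOther p m c r len x
      ∎
    where open ≡-Reasoning

  -- x letters i (overriding m at i) in sequences of length x + L: L letters other than i when m fits.
  countᵢ : Maybe (Fin (suc k)) → Spec (suc k) → ℕ → ℕ → ℕ → ℕ → ℤ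
  countᵢ p m c r L x = + count p (setAt m x) c r (x + L)

  count-split-after-i : ∀ m c r len x →
    count (just i) (setAt m (suc x)) c r (suc len)
      ≡ count (just i) (setAt m x) c r len + startingWithOther (just i) m c r len x
  count-split-after-i m c r len x =
    trans (count-split (just i) m c r len x)
          (cong (λ c' → count (just i) (setAt m x) c' r len + startingWithOther (just i) m c r len x)
                (cong (_+ c) (rise-self i)))

  +[m+n]-+m≡+n : ∀ m n → + (m + n) - + m ≡ + n
  +[m+n]-+m≡+n m n = trans (cong (_- + m) (ℤP.pos-+ m n)) (cancel (+ m) (+ n))
    where
    cancel : ∀ a b → (a +ℤ b) - a ≡ b
    cancel = solve-∀

  -- Induction on L: in x ↦ x + 1 the new sequences are those whose first letter is not i,
  -- and once such a letter is placed only L - 1 letters other than i remain.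
  countᵢ-after-i-deg : ∀ L m c r → Deg< (suc L) (countᵢ (just i) m c r L)
  -- Only from x = 1 on: the value at x = 0 need not fit the polynomial, hence n_i ≥ 1.
  countᵢ-deg : ∀ L m p c r → Deg< (suc L) (countᵢ p m c r L ∘ suc)
  startingWithOther-deg : ∀ L m p c r → Deg< L (λ x → + startingWithOther p m c r (x + L) x)
  countᵢ-pred-deg : ∀ L m p c r → Deg< L (λ x → + count p (setAt m (suc x)) c r (x + L))

  countᵢ-after-i-deg L m c r = Deg<-cong L (λ x → sym (Δcountᵢ x)) (startingWithOther-deg L m (just i) c r)
    where
    Δcountᵢ : ∀ x → Δ (countᵢ (just i) m c r L) x ≡ + startingWithOther (just i) m c r (x + L) x
    Δcountᵢ x = trans (cong (_- + stay) (cong +_ (count-split-after-i m c r (x + L) x)))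
                      (+[m+n]-+m≡+n stay (startingWithOther (just i) m c r (x + L) x))
      where stay = count (just i) (setAt m x) c r (x + L)

  countᵢ-deg L m p c r =
    Deg<-cong (suc L) split
      (Deg<-+ (suc L) {countᵢ (just i) m (rise p i + c) r L} {others} (countᵢ-after-i-deg L m (rise p i + c) r)
                             (Deg<-suc L {others} (startingWithOther-deg L m p c r)))
    where
    others : ℕ → ℤ
    others x = + startingWithOther p m c r (x + L) x
    split : ∀ x → countᵢ (just i) m (rise p i + c) r L x +ℤ + startingWithOther p m c r (x + L) x
                ≡ countᵢ p m c r L (suc x)
    split x = sym (trans (cong +_ (count-split p m c r (x + L) x))
                         (ℤP.pos-+ (count (just i) (setAt m x) (rise p i + c) r (x + L)) _))

  startingWithOther-deg L m p c r =
    Deg<-sum L (allFin k) (λ a x → startingWith p (setAt m (suc x)) c r (x + L) (punchIn i a)) otherFirst-deg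
    where
    otherFirst-deg : ∀ a → Deg< L (λ x → + startingWith p (setAt m (suc x)) c r (x + L) (punchIn i a))
    otherFirst-deg a =
      Deg<-cong L (λ x → cong +_ (sym (startingWith-setAt-≢ p m c r (x + L) (suc x) (punchInᵢ≢i i a))))
        (Deg<-ifPositive L (m a') (countᵢ-pred-deg L (decAt m a') (just a') (rise p a' + c) r))
      where a' = punchIn i a

  countᵢ-pred-deg zero    m p c r x =
    cong +_ (count-occ-overflow i (x + 0) p (setAt m (suc x)) c r
              (subst (x + 0 <_) (sym (setAt-i m (suc x))) (s≤s (ℕP.≤-reflexive (ℕP.+-identityʳ x)))))
  countᵢ-pred-deg (suc L) m p c r =
    Deg<-cong (suc L) (λ x → cong (λ len → + count p (setAt m (suc x)) c r len) (sym (ℕP.+-suc x L)))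
      (countᵢ-deg L m p c r)

module BinomialIdentities {k : ℕ} (i : Fin (suc k)) (n : Spec (suc k)) (1≤nᵢ : 1 ≤ n i) where

  open import Data.Nat using (_+_; _∸_; pred; >-nonZero)
  open import Data.Integer using (_*_; _^_)
  open Counting {suc k}
  open Polynomiality i

  others : ℕ
  others = sum (map (n ∘ punchIn i) (allFin k))

  q : ℕ
  q = pred (n i)

  nᵢ≡1+q : n i ≡ suc q
  nᵢ≡1+q = sym (ℕP.suc-pred (n i) {{>-nonZero 1≤nᵢ}})

  bump≗setAt : ∀ j t → bump n i j t ≡ setAt n (n i + j) t
  bump≗setAt j t with t ≟ᶠ i | i ≟ᶠ t
  ... | yes refl | yes _    = refl
  ... | yes refl | no i≢i   = ⊥-elim (i≢i refl)
  ... | no t≢i   | yes refl = ⊥-elim (t≢i refl)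
  ... | no _     | no _     = refl

  total-bump : ∀ j → total (bump n i j) ≡ n i + j + others
  total-bump j = trans (cong sum (map-cong (bump≗setAt j) (allFin (suc k)))) (total-setAt n (n i + j))

  total+1∸nᵢ≡1+others : total n + 1 ∸ n i ≡ suc others
  total+1∸nᵢ≡1+others = begin
    total n + 1 ∸ n i            ≡⟨ cong (λ t → t + 1 ∸ n i) total≡ ⟩
    n i + others + 1 ∸ n i       ≡⟨ cong (_∸ n i) (ℕP.+-assoc (n i) others 1) ⟩
    n i + (others + 1) ∸ n i     ≡⟨ ℕP.m+n∸m≡n (n i) (others + 1) ⟩
    others + 1                   ≡⟨ ℕP.+-comm others 1 ⟩
    suc others                   ∎
    where
    open ≡-Reasoning
    total≡ : total n ≡ n i + others
    total≡ = trans (cong sum (map-cong (sym ∘ setAt-self n) (allFin (suc k)))) (total-setAt n (n i))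

  s≡countᵢ : ∀ r j → + s (suc k) r (bump n i j) ≡ countᵢ nothing n 0 r others (suc (q + j))
  s≡countᵢ r j = cong +_ (begin
    s (suc k) r (bump n i j)
      ≡⟨ s≡count r (bump n i j) ⟩
    count nothing (bump n i j) 0 r (total (bump n i j))
      ≡⟨ count-cong nothing 0 r (total (bump n i j)) (bump≗setAt j) ⟩
    count nothing (setAt n (n i + j)) 0 r (total (bump n i j))
      ≡⟨ cong (count nothing (setAt n (n i + j)) 0 r) (total-bump j) ⟩
    count nothing (setAt n (n i + j)) 0 r (n i + j + others)
      ≡⟨ cong (λ x → count nothing (setAt n x) 0 r (x + others)) (cong (_+ j) nᵢ≡1+q) ⟩
    count nothing (setAt n (suc (q + j))) 0 r (suc (q + j) + others)
      ∎)
    where open ≡-Reasoning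

  s-deg : ∀ r → Deg< (suc others) (λ j → + s (suc k) r (bump n i j))
  s-deg r = Deg<-cong (suc others) (sym ∘ s≡countᵢ r)
              (Deg<-shift (suc others) q {countᵢ nothing n 0 r others ∘ suc} (countᵢ-deg others n nothing 0 r))

  s-alternating : ∀ r → altSum (total n + 1 ∸ n i) (λ j → + s (suc k) r (bump n i j)) ≡ + 0
  s-alternating r rewrite total+1∸nᵢ≡1+others = altSum-Deg< (suc others) (λ j → + s (suc k) r (bump n i j)) (s-deg r)

  P-alternating : ∀ w → altSum (total n + 1 ∸ n i) (λ j → P (suc k) w (bump n i j)) ≡ + 0
  P-alternating w rewrite total+1∸nᵢ≡1+others = begin
    altSum d (λ j → P (suc k) w (bump n i j))
      ≡⟨ altSum-cong-≤ d (λ j j≤d → P≡∑ w (bump n i j) (total-bump<N j≤d)) ⟩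
    altSum d (λ j → ∑ N (λ r → term r j))
      ≡⟨ altSum-Deg< d (λ j → ∑ N (λ r → term r j))
           (Deg<-∑ d N term (λ r → Deg<-*ʳ d (w ^ r) {λ j → + s (suc k) r (bump n i j)} (s-deg r))) ⟩
    + 0
      ∎
    where
    open ≡-Reasoning
    d N : ℕ
    d = suc others
    N = suc (n i + d + others)
    term : ℕ → ℕ → ℤ
    term r j = + s (suc k) r (bump n i j) * w ^ r
    total-bump<N : ∀ {j} → j ≤ d → total (bump n i j) < N
    total-bump<N {j} j≤d = s≤s (subst (_≤ n i + d + others) (sym (total-bump j))
                                  (ℕP.+-monoˡ-≤ others (ℕP.+-monoʳ-≤ (n i) j≤d)))

open import Data.Nat using (_+_; _∸_)

theorem3 : (k : ℕ) → 1 ≤ k → (i : Fin k) → (n : Spec k) → 1 ≤ n i →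
    ((w : ℤ) → altSum (total n + 1 ∸ n i) (λ j → P k w (bump n i j)) ≡ + 0)
    × ((r : ℕ) → altSum (total n + 1 ∸ n i) (λ j → + s k r (bump n i j)) ≡ + 0)
theorem3 (suc k) _ i n 1≤nᵢ = P-alternating , s-alternating
  where open BinomialIdentities i n 1≤nᵢ
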